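{- Let $\boldsymbol\alpha=(\alpha_1,\dots,\alpha_r)$, $\boldsymbol\beta=(\beta_1,\dots,\beta_s)$ with entries in $\mathbb{Q}\setminus\mathbb{Z}_{\le0}$, write $d=d_{\boldsymbol\alpha,\boldsymbol\beta}$, let $l\ge2$ be an integer and $p$ a prime with $p>M_{\boldsymbol\alpha,\boldsymbol\beta}$. Let $n,e$ be integers with $1\le n\le p$ and $1\le e\le d$ such that either ($n=p$ and $e=d$) or $\frac{e}{d}<\frac np<\frac{e+1}{d}$. Then $$\sum_{i=1}^r\Big\lceil\frac np+\frac{\alpha_i}{p^l}-\mathfrak D_p^l(\alpha_i)\Big\rceil-\sum_{j=1}^s\Big\lceil\frac np+\frac{\beta_j}{p^l}-\mathfrak D_p^l(\beta_j)\Big\rceil=\#\Big\{1\le i\le r:\mathfrak D_p^l(\alpha_i)\le\frac ed\Big\}-\#\Big\{1\le j\le s:\mathfrak D_p^l(\beta_j)\le\frac ed\Big\}.$$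
   Context: $d_{\boldsymbol\alpha,\boldsymbol\beta}$ is the lcm of the reduced denominators of all $\alpha_i,\beta_j$; $M_{\boldsymbol\alpha,\boldsymbol\beta}=d_{\boldsymbol\alpha,\boldsymbol\beta}(2+2\max\{|\alpha_i|,|\beta_j|\})$. Dwork map: for $\gamma\in\mathbb{Z}_p$, $\mathfrak D_p^l(\gamma)$ is the unique element of $\mathbb{Z}_p$ with $p^l\mathfrak D_p^l(\gamma)-\gamma\in\{0,\dots,p^l-1\}$ (the $l$-th iterate of $\mathfrak D_p$, where $p\mathfrak D_p(\gamma)-\gamma\in\{0,\dots,p-1\}$). -}

module Defs where

open import Data.Nat as ℕ using (ℕ; zero; suc; _^_; _<_)
open import Data.Nat.Divisibility using (_∣_)
open import Data.Nat.LCM using (lcm)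
open import Data.Integer as ℤ using (ℤ; +_)
open import Data.Fin using (Fin; zero; suc)
open import Data.Rational as ℚ using (ℚ; _/_; 0ℚ; ∣_∣; _⊔_; _≤_; _-_; _*_; ↧ₙ_)
open import Data.Rational.Properties using (_≤?_)
open import Data.Product using (_×_; Σ)
open import Relation.Nullary using (¬_; Dec; yes; no)
open import Relation.Binary.PropositionalEquality using (_≡_)

-- the rational number a / b for natural numbers a, b (with b ≥ 1 in all uses;
-- the value for b = 0 is an irrelevant default)
ratio : ℕ → ℕ → ℚ
ratio a zero    = 0ℚ
ratio a (suc b) = (+ a) / suc b

ℕ→ℚ : ℕ → ℚ
ℕ→ℚ a = ratio a 1

NotNonPosInt : ℚ → Set
NotNonPosInt q = ¬ ((↧ₙ q ≡ 1) × (q ≤ 0ℚ))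

-- a rational number lies in ℤ_p (as a subset of ℚ_p) iff p does not divide
-- its reduced denominator
InZp : ℕ → ℚ → Set
InZp p q = ¬ (p ∣ ↧ₙ q)

-- δ = 𝔇_p^l(γ): δ ∈ ℤ_p and p^l δ - γ ∈ {0, …, p^l - 1}
-- (the Dwork image of a rational γ ∈ ℤ_p is itself rational, so it suffices
--  to characterise it among rationals; it is unique)
IsDwork : ℕ → ℕ → ℚ → ℚ → Set
IsDwork p l γ δ =
  InZp p δ × Σ ℕ (λ k → (k < p ^ l) × ((ℕ→ℚ (p ^ l) * δ - γ) ≡ ℕ→ℚ k))

sumℤ : (n : ℕ) → (Fin n → ℤ) → ℤ
sumℤ zero    f = + 0
sumℤ (suc n) f = f zero ℤ.+ sumℤ n (λ i → f (suc i))

countLe : (n : ℕ) → (Fin n → ℚ) → ℚ → ℕ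
countLe zero    D c = 0
countLe (suc n) D c with D zero ≤? c
... | yes _ = suc (countLe n (λ i → D (suc i)) c)
... | no  _ = countLe n (λ i → D (suc i)) c

lcmDen : (n : ℕ) → (Fin n → ℚ) → ℕ
lcmDen zero    f = 1
lcmDen (suc n) f = lcm (↧ₙ f zero) (lcmDen n (λ i → f (suc i)))

maxAbs : (n : ℕ) → (Fin n → ℚ) → ℚ
maxAbs zero    f = 0ℚ
maxAbs (suc n) f = ∣ f zero ∣ ⊔ maxAbs n (λ i → f (suc i))

dAB : (r s : ℕ) → (Fin r → ℚ) → (Fin s → ℚ) → ℕ
dAB r s α β = lcm (lcmDen r α) (lcmDen s β)

MAB : (r s : ℕ) → (Fin r → ℚ) → (Fin s → ℚ) → ℚ
MAB r s α β =
  ℕ→ℚ (dAB r s α β) * (ℕ→ℚ 2 ℚ.+ ℕ→ℚ 2 * (maxAbs r α ⊔ maxAbs s β))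

ceilTerm : (n p l : ℕ) → ℚ → ℚ → ℤ
ceilTerm n p l γ δ = ℚ.ceiling (ratio n p ℚ.+ γ * ratio 1 (p ^ l) - δ)

module Submission where

-- Fix one parameter γ (some α_i or β_j) with Dwork image δ, so
-- P·δ − γ = k with 0 ≤ k < P = p^l, and write P = p·Q with Q = p^(l−1) ≥ p
-- (this is where l ≥ 2 is used).
--  * Since p ∤ den δ and P·δ = γ + k, the denominator of δ divides d as the
--    denominator of γ does; so t = d·δ and X = d·γ are integers with
--    P·t = d·k + X, and |X| < p because d·|γ| ≤ M_{α,β} < p.
--  * The argument of the ceiling is n/p + γ/P − δ = T/P with T = n·Q − k,
--    and −P < T ≤ P; hence the ceiling is 1 if T > 0 and 0 if T < 0.
--  * From d·T = Q·(n·d − p·t) + X and the position of n/p between e/d and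
--    (e+1)/d one gets T > 0 when t ≤ e and T < 0 when t > e.
-- So each ceiling term is the indicator of δ ≤ e/d, and summing over the α_i
-- and the β_j gives the two counts.

open import Defs
open import Data.Nat as ℕ using (ℕ; zero; suc; _^_)
import Data.Nat.Properties as ℕP
import Data.Nat.Tactic.RingSolver as ℕS
open import Data.Nat.Divisibility using (_∣_; divides; ∣-trans)
open import Data.Nat.LCM using (m∣lcm[m,n]; n∣lcm[m,n])
open import Data.Nat.Coprimality using (Coprime; coprime-divisor)
import Data.Nat.Coprimality as Coprimality
open import Data.Nat.Primality using (Prime; prime⇒irreducible; ¬prime[0])
open import Data.Integer as ℤ
  using (ℤ; +_; -[1+_]; _+_; _*_; _-_; -_; 0ℤ; 1ℤ; -1ℤ; ∣_∣; +<+; +≤+; -<+; -<-)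
import Data.Integer.Properties as ℤP
open import Data.Integer.DivMod using (a≡a%n+[a/n]*n; n%d<d)
open import Data.Integer.Tactic.RingSolver using (solve; solve-∀)
open import Data.Rational as ℚ using (ℚ; mkℚ; ↥_; ↧_; ↧ₙ_; toℚᵘ; 0ℚ)
import Data.Rational.Properties as ℚP
open import Data.Rational.Unnormalised as ℚᵘ using (mkℚᵘ; *≡*; *≤*)
import Data.Rational.Unnormalised.Properties as ℚᵘP
open import Data.Fin using (Fin; zero; suc)
open import Data.List using (_∷_; [])
open import Data.Product using (_×_; _,_; proj₁; proj₂)
open import Data.Sum using (_⊎_; inj₁; inj₂)
open import Data.Empty using (⊥-elim)
open import Function using (_∘_)
open import Function.Bundles using (_⇔_; mk⇔; Equivalence)
open import Relation.Nullary using (¬_; yes; no)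
open import Relation.Binary.PropositionalEquality

<-suc⇒≤ : ∀ {i j} → i ℤ.< ℤ.suc j → i ℤ.≤ j
<-suc⇒≤ {i} {j} i<j+1 = subst (i ℤ.≤_) (ℤP.pred-suc j) (ℤP.i<j⇒i≤pred[j] i<j+1)

div-unique : ∀ a m z → z * + suc m ℤ.≤ a → a ℤ.< ℤ.suc z * + suc m → a ℤ./ + suc m ≡ z
div-unique a m z lo hi = ℤP.≤-antisym
  (<-suc⇒≤ (ℤP.*-cancelʳ-<-nonNeg D (ℤP.≤-<-trans qD≤a hi)))
  (<-suc⇒≤ (ℤP.*-cancelʳ-<-nonNeg D (ℤP.≤-<-trans lo a<[q+1]D)))
  where
  open ℤP.≤-Reasoning
  D = + suc m
  q = a ℤ./ D
  r = + (a ℤ.% D)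
  a≡r+qD : a ≡ r + q * D
  a≡r+qD = a≡a%n+[a/n]*n a D
  qD≤a : q * D ℤ.≤ a
  qD≤a = subst (q * D ℤ.≤_) (sym a≡r+qD) (ℤP.i≤j⇒i≤k+j r ℤP.≤-refl)
  a<[q+1]D : a ℤ.< ℤ.suc q * D
  a<[q+1]D = begin-strict
    a           ≡⟨ a≡r+qD ⟩
    r + q * D   <⟨ ℤP.+-monoˡ-< (q * D) (+<+ (n%d<d a D)) ⟩
    D + q * D   ≡⟨ ℤP.suc-* q D ⟨
    ℤ.suc q * D ∎

floor-unique : ∀ q z → z * ↧ q ℤ.≤ ↥ q → ↥ q ℤ.< ℤ.suc z * ↧ q → ℚ.floor q ≡ z
floor-unique (mkℚ N D' _) z = div-unique N D' z

-- ⌈x⌉ is the integer z with z − 1 < x ≤ z, because ⌈x⌉ = −⌊−x⌋.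
ceiling-unique : ∀ x z → (z - 1ℤ) * ↧ x ℤ.< ↥ x → ↥ x ℤ.≤ z * ↧ x → ℚ.ceiling x ≡ z
ceiling-unique x@(mkℚ N _ _) z lo hi = begin
  - ℚ.floor (ℚ.- x) ≡⟨ cong -_ (floor-unique (ℚ.- x) (- z) lo′ hi′) ⟩
  - - z             ≡⟨ ℤP.neg-involutive z ⟩
  z                 ∎
  where
  open ≡-Reasoning
  D = ↧ x
  lo′ : - z * ↧ (ℚ.- x) ℤ.≤ ↥ (ℚ.- x)
  lo′ = subst₂ (λ b a → - z * b ℤ.≤ a) (sym (ℚP.↧-neg x)) (sym (ℚP.↥-neg x))
    (subst (ℤ._≤ - N) (ℤP.neg-distribˡ-* z D) (ℤP.neg-mono-≤ hi))
  hi′ : ↥ (ℚ.- x) ℤ.< ℤ.suc (- z) * ↧ (ℚ.- x)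
  hi′ = subst₂ (λ b a → a ℤ.< ℤ.suc (- z) * b) (sym (ℚP.↧-neg x)) (sym (ℚP.↥-neg x))
    (subst (- N ℤ.<_) (neg-shift z D) (ℤP.neg-mono-< lo))
    where
    neg-shift : ∀ z D → - ((z - 1ℤ) * D) ≡ (1ℤ + - z) * D
    neg-shift = solve-∀

ceiling-fraction : ∀ x T P' z → toℚᵘ x ℚᵘ.≃ mkℚᵘ T P'
  → (z - 1ℤ) * + suc P' ℤ.< T → T ℤ.≤ z * + suc P' → ℚ.ceiling x ≡ z
ceiling-fraction x@(mkℚ N D' _) T P' z (*≡* NP≡TD) lo hi = ceiling-unique x z
  (ℤP.*-cancelʳ-<-nonNeg P (begin-strict
     (z - 1ℤ) * D * P ≡⟨ swap (z - 1ℤ) D P ⟩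
     (z - 1ℤ) * P * D <⟨ ℤP.*-monoʳ-<-pos D lo ⟩
     T * D            ≡⟨ NP≡TD ⟨
     N * P            ∎))
  (ℤP.*-cancelʳ-≤-pos N (z * D) P (begin
     N * P            ≡⟨ NP≡TD ⟩
     T * D            ≤⟨ ℤP.*-monoʳ-≤-nonNeg D hi ⟩
     z * P * D        ≡⟨ swap z P D ⟩
     z * D * P        ∎))
  where
  open ℤP.≤-Reasoning
  P = + suc P'
  D = + suc D'
  swap : ∀ a b c → a * b * c ≡ a * c * b
  swap = solve-∀

-- For x = T/P with T = n·Q − k, n ≤ p and 0 ≤ k < P = p·Q one has −P < T ≤ P,
-- so ⌈x⌉ is 1 when T > 0 and 0 when T < 0.
ceiling-by-sign : ∀ {x n p Q k P'} → toℚᵘ x ℚᵘ.≃ mkℚᵘ (+ n * + Q - + k) P'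
  → + suc P' ≡ + p * + Q → n ℕ.≤ p → k ℕ.< p ℕ.* Q
  → (0ℤ ℤ.< + n * + Q - + k → ℚ.ceiling x ≡ 1ℤ)
  × (+ n * + Q - + k ℤ.< 0ℤ → ℚ.ceiling x ≡ 0ℤ)
ceiling-by-sign {x} {n} {p} {Q} {k} {P'} x≃T/P P≡pQ n≤p k<pQ =
  (λ T>0 → ceiling-fraction x T P' 1ℤ x≃T/P T>0 T≤P) ,
  (λ T<0 → ceiling-fraction x T P' 0ℤ x≃T/P -P<T (ℤP.<⇒≤ T<0))
  where
  open ℤP.≤-Reasoning
  T = + n * + Q - + k
  P = + suc P'
  T≤P : T ℤ.≤ 1ℤ * P
  T≤P = begin
    + n * + Q - + k   ≤⟨ ℤP.i≤j⇒i-k≤j (+ k) (ℤP.*-monoʳ-≤-nonNeg (+ Q) (+≤+ n≤p)) ⟩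
    + p * + Q         ≡⟨ P≡pQ ⟨
    P                 ≡⟨ ℤP.*-identityˡ P ⟨
    1ℤ * P            ∎
  -P<T : (0ℤ - 1ℤ) * P ℤ.< T
  -P<T = begin-strict
    (0ℤ - 1ℤ) * P     ≡⟨ ℤP.-1*i≡-i P ⟩
    - P               ≡⟨ cong -_ (trans P≡pQ (sym (ℤP.pos-* p Q))) ⟩
    - + (p ℕ.* Q)     <⟨ ℤP.neg-mono-< (+<+ k<pQ) ⟩
    - + k             ≤⟨ ℤP.i≤j⇒i≤k+j (+ (n ℕ.* Q)) ℤP.≤-refl ⟩
    + (n ℕ.* Q) - + k ≡⟨ cong (_- + k) (ℤP.pos-* n Q) ⟩
    T                 ∎

<⇒0<- : ∀ {i j} → i ℤ.< j → 0ℤ ℤ.< j - i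
<⇒0<- {i} {j} i<j = subst (ℤ._< j - i) (ℤP.+-inverseʳ i) (ℤP.+-monoˡ-< (- i) i<j)

<⇒-<0 : ∀ {i j} → i ℤ.< j → i - j ℤ.< 0ℤ
<⇒-<0 {i} {j} i<j = subst (i - j ℤ.<_) (ℤP.+-inverseʳ j) (ℤP.+-monoˡ-< (- j) i<j)

*-pos⇒pos : ∀ d {T} → 0ℤ ℤ.< + d * T → 0ℤ ℤ.< T
*-pos⇒pos d {T} h = ℤP.*-cancelˡ-<-nonNeg (+ d) (subst (ℤ._< + d * T) (sym (ℤP.*-zeroʳ (+ d))) h)

*-neg⇒neg : ∀ d {T} → + d * T ℤ.< 0ℤ → T ℤ.< 0ℤ
*-neg⇒neg d {T} h = ℤP.*-cancelˡ-<-nonNeg (+ d) (subst (+ d * T ℤ.<_) (sym (ℤP.*-zeroʳ (+ d))) h)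

numerator-identity : ∀ {p Q d k t X} n → p * Q * t ≡ d * k + X
  → d * (n * Q - k) ≡ Q * (n * d - p * t) + X
numerator-identity {p} {Q} {d} {k} {t} {X} n pQt≡dk+X = begin
  d * (n * Q - k)               ≡⟨ solve (p ∷ Q ∷ d ∷ k ∷ t ∷ X ∷ n ∷ []) ⟩
  Q * (n * d) - (d * k + X) + X ≡⟨ cong (λ z → Q * (n * d) - z + X) pQt≡dk+X ⟨
  Q * (n * d) - p * Q * t + X   ≡⟨ solve (p ∷ Q ∷ d ∷ k ∷ t ∷ X ∷ n ∷ []) ⟩
  Q * (n * d - p * t) + X       ∎
  where open ≡-Reasoning

combination-pos : ∀ {p Q m X} → p ℕ.≤ Q → - + p ℤ.< X → 0ℤ ℤ.< m → 0ℤ ℤ.< + Q * m + X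
combination-pos {p} {Q} {m} {X} p≤Q -p<X m>0 = begin-strict
  0ℤ           ≡⟨ ℤP.+-inverseˡ (+ p) ⟨
  - + p + + p  <⟨ ℤP.+-monoˡ-< (+ p) -p<X ⟩
  X + + p      ≤⟨ ℤP.+-monoʳ-≤ X (+≤+ p≤Q) ⟩
  X + + Q      ≡⟨ cong (λ z → X + z) (ℤP.*-identityʳ (+ Q)) ⟨
  X + + Q * 1ℤ ≤⟨ ℤP.+-monoʳ-≤ X (ℤP.*-monoˡ-≤-nonNeg (+ Q) (ℤP.i<j⇒suc[i]≤j m>0)) ⟩
  X + + Q * m  ≡⟨ ℤP.+-comm X (+ Q * m) ⟩
  + Q * m + X  ∎
  where open ℤP.≤-Reasoning

combination-neg : ∀ {p Q m X} → p ℕ.≤ Q → X ℤ.< + p → m ℤ.< 0ℤ → + Q * m + X ℤ.< 0ℤ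
combination-neg {p} {Q} {m} {X} p≤Q X<p m<0 = begin-strict
  + Q * m + X     ≤⟨ ℤP.+-monoˡ-≤ X (ℤP.*-monoˡ-≤-nonNeg (+ Q) (ℤP.i<j⇒i≤pred[j] m<0)) ⟩
  + Q * -1ℤ + X   ≡⟨ cong (_+ X) (ℤP.*-comm (+ Q) -1ℤ) ⟩
  -1ℤ * + Q + X   ≡⟨ cong (_+ X) (ℤP.-1*i≡-i (+ Q)) ⟩
  - + Q + X       ≤⟨ ℤP.+-monoˡ-≤ X (ℤP.neg-mono-≤ (+≤+ p≤Q)) ⟩
  - + p + X       <⟨ ℤP.+-monoʳ-< (- + p) X<p ⟩
  - + p + + p     ≡⟨ ℤP.+-inverseˡ (+ p) ⟩
  0ℤ              ∎
  where open ℤP.≤-Reasoning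

numerator-pos : ∀ {p Q d n e k t X} → + p * + Q * t ≡ + d * + k + X
  → p ℕ.≤ Q → - + p ℤ.< X → k ℕ.< p ℕ.* Q
  → n ≡ p ⊎ + e * + p ℤ.< + n * + d → t ℤ.≤ + e → 0ℤ ℤ.< + n * + Q - + k
numerator-pos {p} {Q} {k = k} _ _ _ k<pQ (inj₁ refl) _ =
  <⇒0<- (subst (+ k ℤ.<_) (ℤP.pos-* p Q) (+<+ k<pQ))
numerator-pos {p} {Q} {d} {n} {e} {k} {t} pQt≡dk+X p≤Q -p<X _ (inj₂ ep<nd) t≤e =
  *-pos⇒pos d (subst (0ℤ ℤ.<_) (sym (numerator-identity {+ p} {+ Q} {+ d} {+ k} (+ n) pQt≡dk+X))
    (combination-pos p≤Q -p<X (<⇒0<- pt<nd)))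
  where
  open ℤP.≤-Reasoning
  pt<nd : + p * t ℤ.< + n * + d
  pt<nd = begin-strict
    + p * t   ≤⟨ ℤP.*-monoˡ-≤-nonNeg (+ p) t≤e ⟩
    + p * + e ≡⟨ ℤP.*-comm (+ p) (+ e) ⟩
    + e * + p <⟨ ep<nd ⟩
    + n * + d ∎

numerator-neg : ∀ {p Q d n e k t X} → + p * + Q * t ≡ + d * + k + X
  → p ℕ.≤ Q → X ℤ.< + p
  → + n * + d ℤ.< + suc e * + p → + e ℤ.< t → + n * + Q - + k ℤ.< 0ℤ
numerator-neg {p} {Q} {d} {n} {e} {k} {t} pQt≡dk+X p≤Q X<p nd<[e+1]p e<t =
  *-neg⇒neg d (subst (ℤ._< 0ℤ) (sym (numerator-identity {+ p} {+ Q} {+ d} {+ k} (+ n) pQt≡dk+X))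
    (combination-neg p≤Q X<p (<⇒-<0 nd<pt)))
  where
  open ℤP.≤-Reasoning
  nd<pt : + n * + d ℤ.< + p * t
  nd<pt = begin-strict
    + n * + d     <⟨ nd<[e+1]p ⟩
    + suc e * + p ≡⟨ ℤP.*-comm (+ suc e) (+ p) ⟩
    + p * + suc e ≤⟨ ℤP.*-monoˡ-≤-nonNeg (+ p) (ℤP.i<j⇒suc[i]≤j e<t) ⟩
    + p * t       ∎

toℚᵘ-ratio : ∀ a m → toℚᵘ (ratio a (suc m)) ℚᵘ.≃ mkℚᵘ (+ a) m
toℚᵘ-ratio a m = ℚP.toℚᵘ-fromℚᵘ (mkℚᵘ (+ a) m)

ratio-<-cross : ∀ a m b m' → ratio a (suc m) ℚ.< ratio b (suc m')
  → + a * + suc m' ℤ.< + b * + suc m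
ratio-<-cross a m b m' a/m<b/m' = ℚᵘP.drop-*<*
  (ℚᵘP.<-respʳ-≃ (toℚᵘ-ratio b m') (ℚᵘP.<-respˡ-≃ (toℚᵘ-ratio a m) (ℚP.toℚᵘ-mono-< a/m<b/m')))

≤-ratio-cross : ∀ δ e m → δ ℚ.≤ ratio e (suc m) ⇔ ↥ δ * + suc m ℤ.≤ + e * ↧ δ
≤-ratio-cross δ@(mkℚ _ _ _) e m = mk⇔
  (λ δ≤e/d → ℚᵘP.drop-*≤* (ℚᵘP.≤-respʳ-≃ (toℚᵘ-ratio e m) (ℚP.toℚᵘ-mono-≤ δ≤e/d)))
  (λ cross → ℚP.toℚᵘ-cancel-≤ (ℚᵘP.≤-respʳ-≃ (ℚᵘP.≃-sym (toℚᵘ-ratio e m)) (*≤* cross)))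

abs-<-cross : ∀ d p γ → ℕ→ℚ d ℚ.* ℚ.∣ γ ∣ ℚ.< ℕ→ℚ p → + d * + ∣ ↥ γ ∣ ℤ.< + p * ↧ γ
abs-<-cross d p γ@(mkℚ a B' _) dγ<p =
  subst₂ ℤ._<_ (ℤP.*-identityʳ (+ d * + ∣ a ∣)) (cong (λ z → + p * + z) (ℕP.*-identityˡ (suc B')))
    (ℚᵘP.drop-*<* (ℚᵘP.<-respʳ-≃ (toℚᵘ-ratio p 0)
      (ℚᵘP.<-respˡ-≃ (ℚᵘP.≃-trans (ℚP.toℚᵘ-homo-* (ℕ→ℚ d) ℚ.∣ γ ∣)
                                    (ℚᵘP.*-congʳ (toℚᵘ-ratio d 0)))
        (ℚP.toℚᵘ-mono-< dγ<p))))

toℚᵘ-*- : ∀ x y z → toℚᵘ (x ℚ.* y ℚ.- z) ℚᵘ.≃ toℚᵘ x ℚᵘ.* toℚᵘ y ℚᵘ.- toℚᵘ z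
toℚᵘ-*- x y z = ℚᵘP.≃-trans (ℚP.toℚᵘ-homo-+ (x ℚ.* y) (ℚ.- z))
  (ℚᵘP.+-cong (ℚP.toℚᵘ-homo-* x y) (ℚP.toℚᵘ-homo‿- z))

toℚᵘ-+*- : ∀ w x y z
  → toℚᵘ (w ℚ.+ x ℚ.* y ℚ.- z) ℚᵘ.≃ toℚᵘ w ℚᵘ.+ toℚᵘ x ℚᵘ.* toℚᵘ y ℚᵘ.- toℚᵘ z
toℚᵘ-+*- w x y z = ℚᵘP.≃-trans (ℚP.toℚᵘ-homo-+ (w ℚ.+ x ℚ.* y) (ℚ.- z))
  (ℚᵘP.+-cong (ℚᵘP.≃-trans (ℚP.toℚᵘ-homo-+ w (x ℚ.* y)) (ℚᵘP.+-congʳ (toℚᵘ w) (ℚP.toℚᵘ-homo-* x y)))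
              (ℚP.toℚᵘ-homo‿- z))

dwork-integral : ∀ P k γ δ → ℕ→ℚ P ℚ.* δ ℚ.- γ ≡ ℕ→ℚ k
  → + P * ↥ δ * ↧ γ ≡ (+ k * ↧ γ + ↥ γ) * ↧ δ
dwork-integral P k γ@(mkℚ a B' _) δ@(mkℚ u V' _) Pδ-γ≡k
  with ℚᵘP.≃-trans (ℚᵘP.≃-sym (ℚᵘP.≃-trans (toℚᵘ-*- (ℕ→ℚ P) δ γ)
                      (ℚᵘP.+-congˡ (ℚᵘ.- mkℚᵘ a B') (ℚᵘP.*-congʳ (toℚᵘ-ratio P 0)))))
                   (ℚᵘP.≃-trans (ℚP.toℚᵘ-cong Pδ-γ≡k) (toℚᵘ-ratio k 0))
... | *≡* cross = rearrange (+ P) u (+ suc B') a (+ suc V') (+ k) cross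
  where
  rearrange : ∀ P u B a V k → ((P * u) * B + (- a) * (+ 1 * V)) * + 1 ≡ k * ((+ 1 * V) * B)
    → P * u * B ≡ (k * B + a) * V
  rearrange P u B a V k cross = begin
    P * u * B                                       ≡⟨ solve (P ∷ u ∷ B ∷ a ∷ V ∷ k ∷ []) ⟩
    ((P * u) * B + (- a) * (+ 1 * V)) * + 1 + a * V ≡⟨ cong (_+ a * V) cross ⟩
    k * ((+ 1 * V) * B) + a * V                     ≡⟨ solve (P ∷ u ∷ B ∷ a ∷ V ∷ k ∷ []) ⟩
    (k * B + a) * V                                 ∎
    where open ≡-Reasoning

ceiling-argument : ∀ n p' P' Q k γ δ → + suc P' ≡ + suc p' * + Q
  → + suc P' * ↥ δ * ↧ γ ≡ (+ k * ↧ γ + ↥ γ) * ↧ δ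
  → toℚᵘ (ratio n (suc p') ℚ.+ γ ℚ.* ratio 1 (suc P') ℚ.- δ) ℚᵘ.≃ mkℚᵘ (+ n * + Q - + k) P'
ceiling-argument n p' P' Q k γ@(mkℚ a B' _) δ@(mkℚ u V' _) P≡pQ dwork =
  ℚᵘP.≃-trans
    (ℚᵘP.≃-trans (toℚᵘ-+*- (ratio n (suc p')) γ (ratio 1 (suc P')) δ)
      (ℚᵘP.+-congˡ (ℚᵘ.- mkℚᵘ u V')
        (ℚᵘP.+-cong (toℚᵘ-ratio n p') (ℚᵘP.*-congˡ {mkℚᵘ a B'} (toℚᵘ-ratio 1 P')))))
    (*≡* (rearrange (+ n) (+ suc p') (+ Q) (+ k) a (+ suc B') u (+ suc V') P≡pQ dwork))
  where
  rearrange : ∀ n p Q k a B u V {P} → P ≡ p * Q → P * u * B ≡ (k * B + a) * V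
    → ((n * (B * P) + (a * + 1) * p) * V + (- u) * (p * (B * P))) * P
      ≡ (n * Q - k) * ((p * (B * P)) * V)
  rearrange n p Q k a B u V refl PuB≡[kB+a]V = begin
    ((n * (B * (p * Q)) + (a * + 1) * p) * V + (- u) * (p * (B * (p * Q)))) * (p * Q)
      ≡⟨ solve (n ∷ p ∷ Q ∷ k ∷ a ∷ B ∷ u ∷ V ∷ []) ⟩
    (p * Q) * p * (n * B * Q * V + a * V) - (p * Q) * p * (p * Q * u * B)
      ≡⟨ cong (λ z → (p * Q) * p * (n * B * Q * V + a * V) - (p * Q) * p * z) PuB≡[kB+a]V ⟩
    (p * Q) * p * (n * B * Q * V + a * V) - (p * Q) * p * ((k * B + a) * V)
      ≡⟨ solve (n ∷ p ∷ Q ∷ k ∷ a ∷ B ∷ u ∷ V ∷ []) ⟩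
    (n * Q - k) * ((p * (B * (p * Q))) * V) ∎
    where open ≡-Reasoning

prime-∤⇒coprime : ∀ {p V} → Prime p → ¬ p ∣ V → Coprime V p
prime-∤⇒coprime p-prime p∤V (g∣V , g∣p) with prime⇒irreducible p-prime g∣p
... | inj₁ g≡1  = g≡1
... | inj₂ refl = ⊥-elim (p∤V g∣V)

coprime-pow-cancel : ∀ {p V} l d → Coprime V p → V ∣ p ^ l ℕ.* d → V ∣ d
coprime-pow-cancel {V = V} zero    d V⊥p V∣ = subst (V ∣_) (ℕP.*-identityˡ d) V∣
coprime-pow-cancel {p} {V} (suc l) d V⊥p V∣ =
  coprime-pow-cancel l d V⊥p (coprime-divisor V⊥p (subst (V ∣_) (ℕP.*-assoc p (p ^ l) d) V∣))

coprime-cancel : ∀ {p V U} l d → Coprime V p → Coprime V U → V ∣ d ℕ.* (p ^ l ℕ.* U) → V ∣ d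
coprime-cancel {p} {V} {U} l d V⊥p V⊥U V∣ =
  coprime-pow-cancel l d V⊥p (coprime-divisor V⊥U (subst (V ∣_) (rearrange d (p ^ l) U) V∣))
  where
  rearrange : ∀ d P U → d ℕ.* (P ℕ.* U) ≡ U ℕ.* (P ℕ.* d)
  rearrange = ℕS.solve-∀

abs-<⇒bounds : ∀ {X p} → + ∣ X ∣ ℤ.< + p → - + p ℤ.< X × X ℤ.< + p
abs-<⇒bounds {_}         {zero}  (+<+ ())
abs-<⇒bounds {+ _}       {suc _} X<p                 = -<+ , X<p
abs-<⇒bounds { -[1+ _ ]} {suc _} (+<+ (ℕ.s≤s m<p)) = -<- m<p , -<+

scale-relation : ∀ {P u B a V k c D} → D ≡ c * B → P * u * B ≡ (k * B + a) * V
  → D * (P * u) ≡ (D * k + c * a) * V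
scale-relation {P} {u} {B} {a} {V} {k} {c} refl PuB≡[kB+a]V = begin
  c * B * (P * u)           ≡⟨ solve (P ∷ u ∷ B ∷ a ∷ V ∷ k ∷ c ∷ []) ⟩
  c * (P * u * B)           ≡⟨ cong (c *_) PuB≡[kB+a]V ⟩
  c * ((k * B + a) * V)     ≡⟨ solve (P ∷ u ∷ B ∷ a ∷ V ∷ k ∷ c ∷ []) ⟩
  (c * B * k + c * a) * V   ∎
  where open ≡-Reasoning

scaled-numerator-bounds : ∀ {c a p} D B' → D ≡ c ℕ.* suc B'
  → + D * + ∣ a ∣ ℤ.< + p * + suc B' → - + p ℤ.< + c * a × + c * a ℤ.< + p
scaled-numerator-bounds {c} {a} {p} D B' refl Da<pB = abs-<⇒bounds (begin-strict
  + ∣ + c * a ∣       ≡⟨ cong +_ (ℤP.abs-* (+ c) a) ⟩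
  + (c ℕ.* ∣ a ∣)     ≡⟨ ℤP.pos-* c ∣ a ∣ ⟩
  + c * + ∣ a ∣       <⟨ ℤP.*-cancelʳ-<-nonNeg (+ suc B') (subst (ℤ._< + p * + suc B') cBa≡caB Da<pB) ⟩
  + p                 ∎)
  where
  open ℤP.≤-Reasoning
  cBa≡caB : + (c ℕ.* suc B') * + ∣ a ∣ ≡ + c * + ∣ a ∣ * + suc B'
  cBa≡caB = trans (cong (_* + ∣ a ∣) (ℤP.pos-* c (suc B'))) (swap (+ c) (+ suc B') (+ ∣ a ∣))
    where
    swap : ∀ c B A → c * B * A ≡ c * A * B
    swap = solve-∀

-- The denominator V of δ = u/V divides D: by the scaled relation it divides
-- D·(P·|u|) with P = p^l, and it is coprime to |u| and (as p ∤ V) to p.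
denominator-divides : ∀ {p l D k c a} δ → Prime p → InZp p δ
  → + D * (+ (p ^ l) * ↥ δ) ≡ (+ D * + k + + c * a) * ↧ δ → ↧ₙ δ ∣ D
denominator-divides {p} {l} {D} {k} {c} {a} (mkℚ u V' u⊥V) p-prime p∤V scaled =
  coprime-cancel l D (prime-∤⇒coprime p-prime p∤V) (Coprimality.sym (Coprimality.recompute u⊥V))
    (divides ∣ N ∣ (begin
      D ℕ.* (P ℕ.* ∣ u ∣)   ≡⟨ cong (D ℕ.*_) (ℤP.abs-* (+ P) u) ⟨
      D ℕ.* ∣ + P * u ∣     ≡⟨ ℤP.abs-* (+ D) (+ P * u) ⟨
      ∣ + D * (+ P * u) ∣   ≡⟨ cong ∣_∣ scaled ⟩
      ∣ N * + suc V' ∣      ≡⟨ ℤP.abs-* N (+ suc V') ⟩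
      ∣ N ∣ ℕ.* suc V'      ∎))
  where
  open ≡-Reasoning
  P = p ^ l
  N = + D * + k + + c * a

-- The parameter γ with Dwork image δ, scaled by d: t = d·δ and X = d·γ are
-- integers with P·t = d·k + X; δ ≤ e/d iff t ≤ e; and −p < X < p.
record Scaled (p P d k : ℕ) (δ : ℚ) : Set where
  field
    t X      : ℤ
    relation : + P * t ≡ + d * + k + X
    compare  : ∀ e → δ ℚ.≤ ratio e d ⇔ t ℤ.≤ + e
    X>-p     : - + p ℤ.< X
    X<p      : X ℤ.< + p

scaled-dwork : ∀ {p d k} l γ δ → Prime p → InZp p δ → ↧ₙ γ ∣ suc d
  → + (p ^ l) * ↥ δ * ↧ γ ≡ (+ k * ↧ γ + ↥ γ) * ↧ δ
  → ℕ→ℚ (suc d) ℚ.* ℚ.∣ γ ∣ ℚ.< ℕ→ℚ p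
  → Scaled p (p ^ l) (suc d) k δ
scaled-dwork {p} {d} {k} l γ@(mkℚ a B' _) δ@(mkℚ u V' _) p-prime p∤V (divides c D≡cB) dwork dγ<p =
  record
    { t        = t
    ; X        = + c * a
    ; relation = ℤP.*-cancelʳ-≡ (+ P * t) (+ D * + k + + c * a) V (begin
        + P * (+ w * u) * V       ≡⟨ regroup (+ P) (+ w) u V ⟩
        (+ w * V) * (+ P * u)     ≡⟨ cong (_* (+ P * u)) D≡wV ⟨
        + D * (+ P * u)           ≡⟨ scaled ⟩
        (+ D * + k + + c * a) * V ∎)
    ; compare  = λ e → let open Equivalence (≤-ratio-cross δ e d) in mk⇔
        (λ δ≤e/d → ℤP.*-cancelʳ-≤-pos t (+ e) V (subst (ℤ._≤ + e * V) uD≡tV (to δ≤e/d)))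
        (λ t≤e → from (subst (ℤ._≤ + e * V) (sym uD≡tV) (ℤP.*-monoʳ-≤-nonNeg V t≤e)))
    ; X>-p     = proj₁ X-bounds
    ; X<p      = proj₂ X-bounds
    }
  where
  open ≡-Reasoning
  P = p ^ l
  D = suc d
  V = + suc V'
  scaled : + D * (+ P * u) ≡ (+ D * + k + + c * a) * V
  scaled = scale-relation {+ P} {u} {+ suc B'} {a} {V} {+ k} {+ c} (trans (cong +_ D≡cB) (ℤP.pos-* c (suc B'))) dwork
  V∣D : suc V' ∣ D
  V∣D = denominator-divides {p} {l} {D} {k} {c} {a} δ p-prime p∤V scaled
  w = _∣_.quotient V∣D
  D≡wV : + D ≡ + w * V
  D≡wV = trans (cong +_ (_∣_.equality V∣D)) (ℤP.pos-* w (suc V'))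
  t = + w * u
  regroup : ∀ P w u V → P * (w * u) * V ≡ (w * V) * (P * u)
  regroup = solve-∀
  uD≡tV : u * + D ≡ t * V
  uD≡tV = trans (cong (u *_) D≡wV) (reorder u (+ w) V)
    where
    reorder : ∀ u w V → u * (w * V) ≡ w * u * V
    reorder = solve-∀
  X-bounds : - + p ℤ.< + c * a × + c * a ℤ.< + p
  X-bounds = scaled-numerator-bounds {c} {a} {p} D B' D≡cB (abs-<-cross D p γ dγ<p)

Window : ℕ → ℕ → ℕ → ℕ → Set
Window p d n e = (n ≡ p × e ≡ d) ⊎ (ratio e d ℚ.< ratio n p × ratio n p ℚ.< ratio (e ℕ.+ 1) d)

window-upper : ∀ {p' d' n e} → Window (suc p') (suc d') n e
  → + n * + suc d' ℤ.< + suc e * + suc p'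
window-upper {p'} {d'} (inj₁ (refl , refl)) = begin-strict
  p * D       ≡⟨ ℤP.*-comm p D ⟩
  D * p       ≡⟨ ℤP.+-identityˡ (D * p) ⟨
  0ℤ + D * p  <⟨ ℤP.+-monoˡ-< (D * p) (+<+ (ℕ.s≤s ℕ.z≤n)) ⟩
  p + D * p   ≡⟨ ℤP.suc-* D p ⟨
  ℤ.suc D * p ∎
  where
  open ℤP.≤-Reasoning
  p = + suc p'
  D = + suc d'
window-upper {p'} {d'} {n} {e} (inj₂ (_ , n/p<[e+1]/d)) =
  subst (λ z → + n * + suc d' ℤ.< + z * + suc p') (ℕP.+-comm e 1)
    (ratio-<-cross n p' (e ℕ.+ 1) d' n/p<[e+1]/d)

window-lower : ∀ {p' d' n e} → Window (suc p') (suc d') n e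
  → n ≡ suc p' ⊎ + e * + suc p' ℤ.< + n * + suc d'
window-lower (inj₁ (n≡p , _))                     = inj₁ n≡p
window-lower {p'} {d'} {n} {e} (inj₂ (e/d<n/p , _)) = inj₂ (ratio-<-cross e d' n p' e/d<n/p)

Indicates : ℤ → ℚ → ℚ → Set
Indicates v δ c = (δ ℚ.≤ c → v ≡ 1ℤ) × (¬ δ ℚ.≤ c → v ≡ 0ℤ)

ceilTerm-indicates : ∀ {p l d n e} γ δ → Prime p → 2 ℕ.≤ l → IsDwork p l γ δ
  → ↧ₙ γ ∣ suc d → ℕ→ℚ (suc d) ℚ.* ℚ.∣ γ ∣ ℚ.< ℕ→ℚ p
  → n ℕ.≤ p → Window p (suc d) n e
  → Indicates (ceilTerm n p l γ δ) δ (ratio e (suc d))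
ceilTerm-indicates {zero} _ _ p-prime = ⊥-elim (¬prime[0] p-prime)
ceilTerm-indicates {suc _} {zero}     _ _ _ ()
ceilTerm-indicates {suc _} {suc zero} _ _ _ (ℕ.s≤s ())
ceilTerm-indicates {suc p'} {suc (suc l')} {d} {n} {e} γ δ p-prime _
                   (p∤V , k , k<pQ , Pδ-γ≡k) B∣D dγ<p n≤p window =
  (λ δ≤e/d → trans ceilTerm≡⌈x⌉ (proj₁ ceiling-sign
     (numerator-pos {p} {Q} {suc d} {n} {e} {k} pQt≡dk+X p≤Q X>-p k<pQ
       (window-lower window) (to (compare e) δ≤e/d)))) ,
  (λ δ≰e/d → trans ceilTerm≡⌈x⌉ (proj₂ ceiling-sign
     (numerator-neg {p} {Q} {suc d} {n} {e} {k} pQt≡dk+X p≤Q X<p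
       (window-upper window) (ℤP.≰⇒> (δ≰e/d ∘ from (compare e))))))
  where
  open Equivalence
  p = suc p'
  Q = p ^ suc l'
  P = p ^ suc (suc l')
  dwork : + P * ↥ δ * ↧ γ ≡ (+ k * ↧ γ + ↥ γ) * ↧ δ
  dwork = dwork-integral P k γ δ Pδ-γ≡k
  open Scaled (scaled-dwork {k = k} (suc (suc l')) γ δ p-prime p∤V B∣D dwork dγ<p)
  pQt≡dk+X : + p * + Q * t ≡ + suc d * + k + X
  pQt≡dk+X = trans (cong (_* t) (sym (ℤP.pos-* p Q))) relation
  -- Q = p^(l−1) ≥ p because l ≥ 2
  p≤Q : p ℕ.≤ Q
  p≤Q = ℕP.m≤m*n p (p ^ l') {{ℕP.m^n≢0 p l'}}
  P' = ℕ.pred P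
  P'+1≡P : suc P' ≡ P
  P'+1≡P = ℕP.suc-pred P {{ℕP.m^n≢0 p (suc (suc l'))}}
  P≡pQ : + suc P' ≡ + p * + Q
  P≡pQ = trans (cong +_ P'+1≡P) (ℤP.pos-* p Q)
  x = ratio n p ℚ.+ γ ℚ.* ratio 1 (suc P') ℚ.- δ
  ceilTerm≡⌈x⌉ : ceilTerm n p (suc (suc l')) γ δ ≡ ℚ.ceiling x
  ceilTerm≡⌈x⌉ = cong (λ m → ℚ.ceiling (ratio n p ℚ.+ γ ℚ.* ratio 1 m ℚ.- δ)) (sym P'+1≡P)
  ceiling-sign : (0ℤ ℤ.< + n * + Q - + k → ℚ.ceiling x ≡ 1ℤ)
               × (+ n * + Q - + k ℤ.< 0ℤ → ℚ.ceiling x ≡ 0ℤ)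
  ceiling-sign = ceiling-by-sign
    (ceiling-argument n p' P' Q k γ δ P≡pQ
      (subst (λ m → + m * ↥ δ * ↧ γ ≡ (+ k * ↧ γ + ↥ γ) * ↧ δ) (sym P'+1≡P) dwork))
    P≡pQ n≤p k<pQ

sum-indicator : ∀ m (f : Fin m → ℤ) (D : Fin m → ℚ) c
  → (∀ i → Indicates (f i) (D i) c) → sumℤ m f ≡ + countLe m D c
sum-indicator zero    f D c ind = refl
sum-indicator (suc m) f D c ind with D zero ℚP.≤? c
... | yes D₀≤c = cong₂ _+_ (proj₁ (ind zero) D₀≤c) rest
  where rest = sum-indicator m (f ∘ suc) (D ∘ suc) c (ind ∘ suc)
... | no D₀≰c = trans (cong₂ _+_ (proj₂ (ind zero) D₀≰c) rest) (ℤP.+-identityˡ _)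
  where rest = sum-indicator m (f ∘ suc) (D ∘ suc) c (ind ∘ suc)

∣∣≤maxAbs : ∀ m (f : Fin m → ℚ) i → ℚ.∣ f i ∣ ℚ.≤ maxAbs m f
∣∣≤maxAbs (suc m) f zero    = ℚP.p≤p⊔q ℚ.∣ f zero ∣ (maxAbs m (f ∘ suc))
∣∣≤maxAbs (suc m) f (suc i) = ℚP.p≤q⇒p≤r⊔q ℚ.∣ f zero ∣ (∣∣≤maxAbs m (f ∘ suc) i)

maxAbs-nonNeg : ∀ m (f : Fin m → ℚ) → 0ℚ ℚ.≤ maxAbs m f
maxAbs-nonNeg zero    f = ℚP.≤-refl
maxAbs-nonNeg (suc m) f =
  ℚP.≤-trans (ℚP.0≤∣p∣ (f zero)) (ℚP.p≤p⊔q ℚ.∣ f zero ∣ (maxAbs m (f ∘ suc)))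

↧ₙ∣lcmDen : ∀ m (f : Fin m → ℚ) i → ↧ₙ (f i) ∣ lcmDen m f
↧ₙ∣lcmDen (suc m) f zero    = m∣lcm[m,n] (↧ₙ f zero) (lcmDen m (f ∘ suc))
↧ₙ∣lcmDen (suc m) f (suc i) =
  ∣-trans (↧ₙ∣lcmDen m (f ∘ suc) i) (n∣lcm[m,n] (↧ₙ f zero) (lcmDen m (f ∘ suc)))

≤2+2* : ∀ M → 0ℚ ℚ.≤ M → M ℚ.≤ ℕ→ℚ 2 ℚ.+ ℕ→ℚ 2 ℚ.* M
≤2+2* M M≥0 = begin
  M                     ≡⟨ ℚP.+-identityˡ M ⟨
  0ℚ ℚ.+ M              ≤⟨ ℚP.+-monoˡ-≤ M (ℚP.+-mono-≤ (ℚP.nonNegative⁻¹ (ℕ→ℚ 2)) M≥0) ⟩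
  (ℕ→ℚ 2 ℚ.+ M) ℚ.+ M   ≡⟨ ℚP.+-assoc (ℕ→ℚ 2) M M ⟩
  ℕ→ℚ 2 ℚ.+ (M ℚ.+ M)   ≡⟨ cong (ℕ→ℚ 2 ℚ.+_) M+M≡2M ⟩
  ℕ→ℚ 2 ℚ.+ ℕ→ℚ 2 ℚ.* M ∎
  where
  open ℚP.≤-Reasoning
  M+M≡2M : M ℚ.+ M ≡ ℕ→ℚ 2 ℚ.* M
  M+M≡2M = trans (cong₂ ℚ._+_ (sym (ℚP.*-identityˡ M)) (sym (ℚP.*-identityˡ M)))
                 (sym (ℚP.*-distribʳ-+ M ℚ.1ℚ ℚ.1ℚ))

ceilTerm-sum : ∀ {p l d n e} m (γ D : Fin m → ℚ) → Prime p → 2 ℕ.≤ l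
  → (∀ i → IsDwork p l (γ i) (D i))
  → (∀ i → ↧ₙ (γ i) ∣ d) → (∀ i → ℕ→ℚ d ℚ.* ℚ.∣ γ i ∣ ℚ.< ℕ→ℚ p)
  → 1 ℕ.≤ d → n ℕ.≤ p → Window p d n e
  → sumℤ m (λ i → ceilTerm n p l (γ i) (D i)) ≡ + countLe m D (ratio e d)
ceilTerm-sum {d = suc _} m γ D p-prime 2≤l dwork den∣d dγ<p _ n≤p window =
  sum-indicator m _ D _ λ i →
    ceilTerm-indicates (γ i) (D i) p-prime 2≤l (dwork i) (den∣d i) (dγ<p i) n≤p window

lemma2p10 : (r s : ℕ) (α : Fin r → ℚ) (β : Fin s → ℚ)
    → (∀ i → NotNonPosInt (α i)) → (∀ j → NotNonPosInt (β j))
    → (l : ℕ) → 2 ℕ.≤ l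
    → (p : ℕ) → Prime p → MAB r s α β ℚ.< ℕ→ℚ p
    → (Dα : Fin r → ℚ) → (∀ i → IsDwork p l (α i) (Dα i))
    → (Dβ : Fin s → ℚ) → (∀ j → IsDwork p l (β j) (Dβ j))
    → (n e : ℕ) → 1 ℕ.≤ n → n ℕ.≤ p → 1 ℕ.≤ e → e ℕ.≤ dAB r s α β
    → ((n ≡ p) × (e ≡ dAB r s α β))
      ⊎ ((ratio e (dAB r s α β) ℚ.< ratio n p)
         × (ratio n p ℚ.< ratio (e ℕ.+ 1) (dAB r s α β)))
    → sumℤ r (λ i → ceilTerm n p l (α i) (Dα i))
        - sumℤ s (λ j → ceilTerm n p l (β j) (Dβ j))
      ≡ + countLe r Dα (ratio e (dAB r s α β))
        - + countLe s Dβ (ratio e (dAB r s α β))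
lemma2p10 r s α β _ _ l 2≤l p p-prime M<p Dα α-dwork Dβ β-dwork n e _ n≤p 1≤e e≤d window =
  cong₂ _-_
    (ceilTerm-sum r α Dα p-prime 2≤l α-dwork
      (λ i → ∣-trans (↧ₙ∣lcmDen r α i) (m∣lcm[m,n] (lcmDen r α) (lcmDen s β)))
      (λ i → d·g<p (ℚP.≤-trans (∣∣≤maxAbs r α i) (ℚP.p≤p⊔q (maxAbs r α) (maxAbs s β))))
      d≥1 n≤p window)
    (ceilTerm-sum s β Dβ p-prime 2≤l β-dwork
      (λ j → ∣-trans (↧ₙ∣lcmDen s β j) (n∣lcm[m,n] (lcmDen r α) (lcmDen s β)))
      (λ j → d·g<p (ℚP.≤-trans (∣∣≤maxAbs s β j) (ℚP.p≤q⊔p (maxAbs r α) (maxAbs s β))))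
      d≥1 n≤p window)
  where
  d = dAB r s α β
  M = maxAbs r α ℚ.⊔ maxAbs s β
  d≥1 : 1 ℕ.≤ d
  d≥1 = ℕP.≤-trans 1≤e e≤d
  -- every g ≤ M has d·g ≤ d·(2 + 2M) = M_{α,β} < p
  d·g<p : ∀ {g} → g ℚ.≤ M → ℕ→ℚ d ℚ.* g ℚ.< ℕ→ℚ p
  d·g<p g≤M = ℚP.≤-<-trans
    (ℚP.*-monoˡ-≤-nonNeg (ℕ→ℚ d) {{ℚP.normalize-nonNeg d 1}}
      (ℚP.≤-trans g≤M (≤2+2* M (ℚP.≤-trans (maxAbs-nonNeg r α) (ℚP.p≤p⊔q (maxAbs r α) (maxAbs s β))))))
    M<p
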